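{- Let $a\geq 2$ be an integer and let $A=(a_{ij})$ be an $n\times n$ real symmetric matrix with $a_{ii}=1$ for all $i$ and $a_{ij}=s_{ij}a$ for $i\neq j$, where $s_{ij}\in\{0,1\}$. Then $\operatorname{rank}(A)=n$.
   Formalization: The matrix A is taken over ℚ rather than ℝ, and full rank means that no nonzero rational vector lies in its kernel. -}

module Defs where

open import Data.Nat using (ℕ)
open import Data.Fin using (Fin)
open import Data.Rational using (ℚ; 0ℚ; _+_; _*_)
open import Data.Vec.Functional using (foldr)
open import Relation.Binary.PropositionalEquality using (_≡_)

Matrix : ℕ → Set
Matrix n = Fin n → Fin n → ℚ

sumℚ : ∀ {n} → (Fin n → ℚ) → ℚ
sumℚ v = foldr _+_ 0ℚ v

mulVec : ∀ {n} → Matrix n → (Fin n → ℚ) → (Fin n → ℚ)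
mulVec A x i = sumℚ (λ j → A i j * x j)

-- rank A = n : the columns of A are linearly independent, i.e. A x = 0 ⇒ x = 0.
FullRank : ∀ {n} → Matrix n → Set
FullRank {n} A = ∀ (x : Fin n → ℚ) → (∀ i → mulVec A x i ≡ 0ℚ) → ∀ j → x j ≡ 0ℚ

{-# OPTIONS --safe #-}
-- Clearing denominators turns a rational kernel vector x of A into an integer
-- vector w with M w = 0, where M is A read as an integer matrix, M ≡ I (mod a).
-- If a^k divides every entry of w, then w = M w - (M - I) w is divisible by
-- a^(k+1); so every power of a divides every w_j, which forces w_j = 0 because
-- |w_j| < a^|w_j|. As the clearing factor is nonzero, x = 0.
module Submission where

open import Algebra.Bundles using (Monoid; CommutativeMonoid; CommutativeRing)
open import Algebra.Morphism.Structures using (IsMonoidHomomorphism)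
import Algebra.Properties.Monoid.Sum as MonoidSum
open import Data.Fin using (Fin; zero; suc; _≟_; punchIn)
open import Data.Fin.Properties using (punchInᵢ≢i)
open import Data.Integer using (ℤ; +_; 0ℤ; 1ℤ; _+_; _*_; _-_; ∣_∣; NonZero)
open import Data.Integer.Divisibility.Signed
  using ( _∣_; divides; ∣⇒∣ᵤ; ∣-reflexive; ∣-trans
        ; ∣m∣n⇒∣m+n; ∣m+n∣m⇒∣n; ∣m+n∣n⇒∣m; *-monoʳ-∣; *-monoˡ-∣)
open import Data.Integer.GCD using (gcd-zeroʳ)
import Data.Integer.Properties as ℤ
open import Data.Integer.Tactic.RingSolver using (solve-∀)
open import Data.Nat using (ℕ; _≥_)
import Data.Nat as ℕ
open import Data.Nat.Divisibility as ℕ using (>⇒∤)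
import Data.Nat.Properties as ℕ
open import Data.Product using (∃₂; _×_; _,_)
open import Data.Rational using (ℚ; 0ℚ; 1ℚ; _/_; toℚᵘ)
import Data.Rational as ℚ
import Data.Rational.Properties as ℚ
open import Data.Rational.Unnormalised as ℚᵘ using (ℚᵘ; mkℚᵘ; _≃_; *≡*; ↥_; ↧_; 0ℚᵘ)
import Data.Rational.Unnormalised.Properties as ℚᵘ
open import Data.Sum using (_⊎_; [_,_]′)
open import Data.Vec.Functional using (Vector; map; head; tail)
open import Relation.Binary.PropositionalEquality using (_≡_; _≢_; refl; sym; trans; cong; cong₂; subst)
open import Relation.Nullary using (yes; no; contradiction)

open import Defs

open import Algebra.Properties.Semiring.Sum ℤ.+-*-semiring
  using (sum-remove) renaming (sum to ∑ℤ)
open import Algebra.Properties.Semiring.Sum (CommutativeRing.semiring ℚᵘ.+-*-commutativeRing)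
  using (sum-cong-≋; *-distribˡ-sum) renaming (sum to ∑ᵘ)
open import Algebra.Properties.CommutativeSemigroup
  (CommutativeMonoid.commutativeSemigroup ℚᵘ.*-1-commutativeMonoid)
  using (x∙yz≈y∙xz)

n<m^n : ∀ {m} → 1 ℕ.< m → ∀ n → n ℕ.< m ℕ.^ n
n<m^n 1<m ℕ.zero    = ℕ.z<s
n<m^n 1<m (ℕ.suc n) = ℕ.≤-<-trans (n<m^n 1<m n) (ℕ.^-monoʳ-< _ 1<m (ℕ.n<1+n n))

m^n∣n⇒n≡0 : ∀ {m n} → 1 ℕ.< m → m ℕ.^ n ℕ.∣ n → n ≡ 0
m^n∣n⇒n≡0 {n = ℕ.zero}  _   _     = refl
m^n∣n⇒n≡0 {n = ℕ.suc n} 1<m m^n∣n = contradiction m^n∣n (>⇒∤ (n<m^n 1<m (ℕ.suc n)))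

∣-all-powers⇒≡0 : ∀ {d} → 1 ℕ.< d → ∀ z → (∀ k → + (d ℕ.^ k) ∣ z) → z ≡ 0ℤ
∣-all-powers⇒≡0 1<d z d^k∣z = ℤ.∣i∣≡0⇒i≡0 (m^n∣n⇒n≡0 1<d (∣⇒∣ᵤ (d^k∣z ∣ z ∣)))

_∣0 : ∀ d → d ∣ 0ℤ
d ∣0 = divides 0ℤ (sym (ℤ.*-zeroˡ d))

*-pres-∣ : ∀ {a b m n} → a ∣ m → b ∣ n → a * b ∣ m * n
*-pres-∣ {b = b} {m = m} a∣m b∣n = ∣-trans (*-monoˡ-∣ b a∣m) (*-monoʳ-∣ m b∣n)

∣-sum : ∀ {d n} (f : Vector ℤ n) → (∀ j → d ∣ f j) → d ∣ ∑ℤ f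
∣-sum {d} {ℕ.zero} f _     = d ∣0
∣-sum {n = ℕ.suc n} f d∣f = ∣m∣n⇒∣m+n (d∣f zero) (∣-sum (tail f) (λ j → d∣f (suc j)))

∣-sum-cancel : ∀ {d n} (f : Vector ℤ n) i → d ∣ ∑ℤ f → (∀ j → j ≢ i → d ∣ f j) → d ∣ f i
∣-sum-cancel {n = ℕ.suc _} f i d∣∑f d∣others =
  ∣m+n∣n⇒∣m (subst (_ ∣_) (sum-remove {i = i} f) d∣∑f)
            (∣-sum _ (λ j → d∣others (punchIn i j) (punchInᵢ≢i i j)))

record IsIdentityModulo {n} (d : ℕ) (M : Fin n → Fin n → ℤ) : Set where
  field
    diagonal    : ∀ i → + d ∣ M i i - 1ℤ
    offDiagonal : ∀ i j → i ≢ j → + d ∣ M i j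

module _ {n d} {M : Fin n → Fin n → ℤ} (M≡I : IsIdentityModulo d M)
         {w : Fin n → ℤ} (Mw≡0 : ∀ i → ∑ℤ (λ j → M i j * w j) ≡ 0ℤ) where
  open IsIdentityModulo M≡I

  powers-∣-kernel : ∀ k j → + (d ℕ.^ k) ∣ w j
  powers-∣-kernel ℕ.zero    j = divides (w j) (sym (ℤ.*-identityʳ (w j)))
  powers-∣-kernel (ℕ.suc k) i =
    ∣m+n∣m⇒∣n (subst (D ∣_) (mw≡[m-1]w+w (M i i) (w i)) D∣Mᵢᵢwᵢ) D∣[Mᵢᵢ-1]wᵢ
    where
    D = + (d ℕ.^ ℕ.suc k)
    D∣ : ∀ {m v} → + d ∣ m → + (d ℕ.^ k) ∣ v → D ∣ m * v
    D∣ d∣m d^k∣v = subst (_∣ _) (sym (ℤ.pos-* d (d ℕ.^ k))) (*-pres-∣ d∣m d^k∣v)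
    D∣Mᵢᵢwᵢ : D ∣ M i i * w i
    D∣Mᵢᵢwᵢ = ∣-sum-cancel (λ j → M i j * w j) i (subst (D ∣_) (sym (Mw≡0 i)) (D ∣0))
      (λ j j≢i → D∣ (offDiagonal i j (λ i≡j → j≢i (sym i≡j))) (powers-∣-kernel k j))
    D∣[Mᵢᵢ-1]wᵢ : D ∣ (M i i - 1ℤ) * w i
    D∣[Mᵢᵢ-1]wᵢ = D∣ (diagonal i) (powers-∣-kernel k i)
    mw≡[m-1]w+w : ∀ m w → m * w ≡ (m - 1ℤ) * w + w
    mw≡[m-1]w+w = solve-∀

  kernel-trivial : 1 ℕ.< d → ∀ j → w j ≡ 0ℤ
  kernel-trivial 1<d j = ∣-all-powers⇒≡0 1<d (w j) (λ k → powers-∣-kernel k j)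

module _ {a b ℓ₁ ℓ₂} (M₁ : Monoid a ℓ₁) (M₂ : Monoid b ℓ₂) where
  private
    module M₁ = Monoid M₁
    module M₂ = Monoid M₂

  sum-homo : ∀ {f} → IsMonoidHomomorphism M₁.rawMonoid M₂.rawMonoid f → ∀ {n} (v : Vector M₁.Carrier n) →
             f (MonoidSum.sum M₁ v) M₂.≈ MonoidSum.sum M₂ (map f v)
  sum-homo f-homo {ℕ.zero}  v = IsMonoidHomomorphism.ε-homo f-homo
  sum-homo f-homo {ℕ.suc n} v =
    M₂.trans (IsMonoidHomomorphism.homo f-homo (head v) _) (M₂.∙-congˡ (sum-homo f-homo (tail v)))

fromℤ : ℤ → ℚᵘ
fromℤ z = mkℚᵘ z 0

fromℤ-isMonoidHomomorphism-+ :
  IsMonoidHomomorphism (Monoid.rawMonoid ℤ.+-0-monoid) (Monoid.rawMonoid ℚᵘ.+-0-monoid) fromℤ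
fromℤ-isMonoidHomomorphism-+ = record
  { isMagmaHomomorphism = record
    { isRelHomomorphism = record { cong = λ i≡j → ℚᵘ.≃-reflexive (cong fromℤ i≡j) }
    ; homo              = λ i j → *≡* (cong (_* 1ℤ) (sym (cong₂ _+_ (ℤ.*-identityʳ i) (ℤ.*-identityʳ j))))
    }
  ; ε-homo = ℚᵘ.≃-refl
  }

fromℤ≃0⇒≡0 : ∀ {z} → fromℤ z ≃ 0ℚᵘ → z ≡ 0ℤ
fromℤ≃0⇒≡0 {z} (*≡* z≡0) = trans (sym (ℤ.*-identityʳ z)) z≡0

↧p*p≃↥p : ∀ p → fromℤ (↧ p) ℚᵘ.* p ≃ fromℤ (↥ p)
↧p*p≃↥p (mkℚᵘ n d-1) = *≡* (trans (ℤ.*-identityʳ _)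
  (trans (ℤ.*-comm _ n) (cong (λ d → n * + d) (sym (ℕ.*-identityˡ (ℕ.suc d-1))))))

clear-denominators : ∀ {n} (u : Vector ℚᵘ n) →
                     ∃₂ λ c (w : Vector ℤ n) → NonZero c × (∀ j → fromℤ c ℚᵘ.* u j ≃ fromℤ (w j))
clear-denominators {ℕ.zero}  u = 1ℤ , (λ ()) , _ , (λ ())
clear-denominators {ℕ.suc n} u with clear-denominators (tail u)
... | c , w , c≢0 , cu≃w = c * ↧ u₀ , w′ , ℤ.i*j≢0 c (↧ u₀) {{c≢0}} , c′u≃w′
  where
  open import Relation.Binary.Reasoning.Setoid ℚᵘ.≃-setoid
  u₀ = head u
  w′ : Vector ℤ (ℕ.suc n)
  w′ zero    = c * ↥ u₀
  w′ (suc j) = ↧ u₀ * w j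
  c′u≃w′ : ∀ j → fromℤ (c * ↧ u₀) ℚᵘ.* u j ≃ fromℤ (w′ j)
  c′u≃w′ zero = begin
    fromℤ c ℚᵘ.* fromℤ (↧ u₀) ℚᵘ.* u₀    ≈⟨ ℚᵘ.*-assoc (fromℤ c) (fromℤ (↧ u₀)) u₀ ⟩
    fromℤ c ℚᵘ.* (fromℤ (↧ u₀) ℚᵘ.* u₀)  ≈⟨ ℚᵘ.*-congˡ {fromℤ c} (↧p*p≃↥p u₀) ⟩
    fromℤ c ℚᵘ.* fromℤ (↥ u₀)            ∎
  c′u≃w′ (suc j) = begin
    fromℤ (c * ↧ u₀) ℚᵘ.* u (suc j)
      ≈⟨ ℚᵘ.*-congʳ {u (suc j)} (ℚᵘ.≃-reflexive (cong fromℤ (ℤ.*-comm c (↧ u₀)))) ⟩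
    fromℤ (↧ u₀) ℚᵘ.* fromℤ c ℚᵘ.* u (suc j)
      ≈⟨ ℚᵘ.*-assoc (fromℤ (↧ u₀)) (fromℤ c) (u (suc j)) ⟩
    fromℤ (↧ u₀) ℚᵘ.* (fromℤ c ℚᵘ.* u (suc j))
      ≈⟨ ℚᵘ.*-congˡ {fromℤ (↧ u₀)} (cu≃w j) ⟩
    fromℤ (↧ u₀) ℚᵘ.* fromℤ (w j) ∎

fromℤ-*-toℚᵘ≃0⇒≡0 : ∀ c .{{_ : NonZero c}} r → fromℤ c ℚᵘ.* toℚᵘ r ≃ 0ℚᵘ → r ≡ 0ℚ
fromℤ-*-toℚᵘ≃0⇒≡0 c r@record{} (*≡* c↥r≡0) = ℚ.↥p≡0⇒p≡0 r
  (ℤ.*-cancelˡ-≡ c _ 0ℤ (trans (sym (ℤ.*-identityʳ _)) (trans c↥r≡0 (sym (ℤ.*-zeroʳ c)))))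

toℚᵘ-mulVec : ∀ {n} (A : Matrix n) x i →
              toℚᵘ (mulVec A x i) ≃ ∑ᵘ (λ j → toℚᵘ (A i j) ℚᵘ.* toℚᵘ (x j))
toℚᵘ-mulVec A x i = ℚᵘ.≃-trans
  (sum-homo ℚ.+-0-monoid ℚᵘ.+-0-monoid ℚ.toℚᵘ-isMonoidHomomorphism-+ (λ j → A i j ℚ.* x j))
  (sum-cong-≋ (λ j → ℚ.toℚᵘ-homo-* (A i j) (x j)))

cleared-kernel⇒integer-kernel :
  ∀ {n} (A : Matrix n) (M : Fin n → Fin n → ℤ) → (∀ i j → A i j ≡ M i j / 1) →
  ∀ {x : Fin n → ℚ} {c : ℤ} {w : Fin n → ℤ} →
  (∀ j → fromℤ c ℚᵘ.* toℚᵘ (x j) ≃ fromℤ (w j)) → (∀ i → mulVec A x i ≡ 0ℚ) →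
  ∀ i → ∑ℤ (λ j → M i j * w j) ≡ 0ℤ
cleared-kernel⇒integer-kernel A M A≡M {x} {c} {w} cx≃w Ax≡0 i = fromℤ≃0⇒≡0 (begin
  fromℤ (∑ℤ (λ j → M i j * w j))
    ≈⟨ sum-homo ℤ.+-0-monoid ℚᵘ.+-0-monoid fromℤ-isMonoidHomomorphism-+ (λ j → M i j * w j) ⟩
  ∑ᵘ (λ j → fromℤ (M i j) ℚᵘ.* fromℤ (w j))
    ≈⟨ sum-cong-≋ (λ j → ℚᵘ.*-cong (Mᵢⱼ≃Aᵢⱼ j) (ℚᵘ.≃-sym (cx≃w j))) ⟩
  ∑ᵘ (λ j → toℚᵘ (A i j) ℚᵘ.* (fromℤ c ℚᵘ.* toℚᵘ (x j)))
    ≈⟨ sum-cong-≋ (λ j → x∙yz≈y∙xz (toℚᵘ (A i j)) (fromℤ c) (toℚᵘ (x j))) ⟩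
  ∑ᵘ (λ j → fromℤ c ℚᵘ.* (toℚᵘ (A i j) ℚᵘ.* toℚᵘ (x j)))
    ≈⟨ *-distribˡ-sum (fromℤ c) (λ j → toℚᵘ (A i j) ℚᵘ.* toℚᵘ (x j)) ⟨
  fromℤ c ℚᵘ.* ∑ᵘ (λ j → toℚᵘ (A i j) ℚᵘ.* toℚᵘ (x j))
    ≈⟨ ℚᵘ.*-congˡ {fromℤ c} (toℚᵘ-mulVec A x i) ⟨
  fromℤ c ℚᵘ.* toℚᵘ (mulVec A x i)
    ≈⟨ ℚᵘ.*-congˡ {fromℤ c} (ℚᵘ.≃-reflexive (cong toℚᵘ (Ax≡0 i))) ⟩
  fromℤ c ℚᵘ.* toℚᵘ 0ℚ
    ≈⟨ ℚᵘ.*-zeroʳ (fromℤ c) ⟩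
  0ℚᵘ ∎)
  where
  open import Relation.Binary.Reasoning.Setoid ℚᵘ.≃-setoid
  Mᵢⱼ≃Aᵢⱼ : ∀ j → fromℤ (M i j) ≃ toℚᵘ (A i j)
  Mᵢⱼ≃Aᵢⱼ j = ℚᵘ.≃-sym (ℚᵘ.≃-trans (ℚᵘ.≃-reflexive (cong toℚᵘ (A≡M i j)))
                                   (ℚ.toℚᵘ-fromℚᵘ (fromℤ (M i j))))

integral-≡I-mod⇒FullRank : ∀ {n d} → 1 ℕ.< d → (A : Matrix n) (M : Fin n → Fin n → ℤ) →
                           (∀ i j → A i j ≡ M i j / 1) → IsIdentityModulo d M → FullRank A
integral-≡I-mod⇒FullRank 1<d A M A≡M M≡I x Ax≡0 j with clear-denominators (λ j → toℚᵘ (x j))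
... | c , w , c≢0 , cx≃w =
  fromℤ-*-toℚᵘ≃0⇒≡0 c {{c≢0}} (x j) (ℚᵘ.≃-trans (cx≃w j) (ℚᵘ.≃-reflexive (cong fromℤ (w≡0 j))))
  where
  w≡0 : ∀ j → w j ≡ 0ℤ
  w≡0 = kernel-trivial M≡I (cleared-kernel⇒integer-kernel A M A≡M cx≃w Ax≡0) 1<d

↥[z/1]≡z : ∀ z → ℚ.↥ (z / 1) ≡ z
↥[z/1]≡z z = trans (sym (ℤ.*-identityʳ _))
  (trans (cong (ℚ.↥ (z / 1) *_) (sym (gcd-zeroʳ z))) (ℚ.↥-/ z 1))

≡z/1⇒≡↥/1 : ∀ {r} z → r ≡ z / 1 → r ≡ ℚ.↥ r / 1
≡z/1⇒≡↥/1 z refl = cong (_/ 1) (sym (↥[z/1]≡z z))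

≡0∨≡d/1⇒d∣↥ : ∀ {r d} → r ≡ 0ℚ ⊎ r ≡ d / 1 → d ∣ ℚ.↥ r
≡0∨≡d/1⇒d∣↥ {d = d} = [ (λ { refl → d ∣0 }) , (λ { refl → ∣-reflexive (sym (↥[z/1]≡z d)) }) ]′

lemma3p1 : (a : ℕ) → a ≥ 2 → (n : ℕ) → (A : Matrix n) →
    (∀ i j → A i j ≡ A j i) →
    (∀ i → A i i ≡ 1ℚ) →
    (∀ i j → i ≢ j → (A i j ≡ 0ℚ) ⊎ (A i j ≡ + a / 1)) →
    FullRank A
lemma3p1 a a≥2 n A _ diag off = integral-≡I-mod⇒FullRank a≥2 A (λ i j → ℚ.↥ (A i j)) A≡↥A/1 ↥A≡I
  where
  A≡↥A/1 : ∀ i j → A i j ≡ ℚ.↥ (A i j) / 1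
  A≡↥A/1 i j with i ≟ j
  ... | yes refl = ≡z/1⇒≡↥/1 1ℤ (diag i)
  ... | no i≢j   = [ ≡z/1⇒≡↥/1 0ℤ , ≡z/1⇒≡↥/1 (+ a) ]′ (off i j i≢j)
  ↥A≡I : IsIdentityModulo a (λ i j → ℚ.↥ (A i j))
  ↥A≡I = record
    { diagonal    = λ i → subst (λ r → + a ∣ ℚ.↥ r - 1ℤ) (sym (diag i)) ((+ a) ∣0)
    ; offDiagonal = λ i j i≢j → ≡0∨≡d/1⇒d∣↥ (off i j i≢j)
    }
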